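{- Let $w\in\Sigma^n$ and for each letter $q$ occurring in $w$ let $i_q$ be the position of the leftmost occurrence of $q$ in $w$. Then every path of length $j$ in $\mathrm{NEG}(w)$ starting at a vertex $v_{i_q}$ corresponds to a unique subsequence of $w$: if $(v_{p_1},\dots,v_{p_j})$ and $(v_{q_1},\dots,v_{q_j})$ are two such paths (each starting at the leftmost occurrence of its first letter) with $w[p_1]\cdots w[p_j]=w[q_1]\cdots w[q_j]$, then $(p_1,\dots,p_j)=(q_1,\dots,q_j)$.
   Context: For $w\in\Sigma^n$ over the ordered alphabet $\Sigma=\{1,\dots,\sigma\}$, $\mathrm{NEG}(w)$ is the directed edge-labelled graph with vertices $v_1,\dots,v_n$, where for $1\le i<j\le n$ there is an edge $(v_i,v_j)$ labelled $\uparrow$ if $w[i]<w[j]$ and every $j'\in[i+1,j-1]$ satisfies $w[j']<w[i]$ or $w[j']>w[j]$; labelled $\rightarrow$ if $w[i]=w[j]$ and $i$ is the largest index smaller than $j$ with $w[i]=w[j]$; labelled $\downarrow$ if $w[i]>w[j]$ and every $j'\in[i+1,j-1]$ satisfies $w[j']>w[i]$ or $w[j']<w[j]$; and no edge otherwise. A path $(v_{p_1},\dots,v_{p_j})$ corresponds to the subsequence $w[p_1]\cdots w[p_j]$. -}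

module Defs where

open import Data.Nat using (ℕ; suc)
open import Data.Fin using (Fin; _<_; _>_)
open import Data.Vec using (Vec; []; _∷_; map)
open import Data.Product using (_×_; ∃)
open import Data.Unit using (⊤)
open import Data.Sum using (_⊎_)
open import Relation.Binary.PropositionalEquality using (_≡_; _≢_)

-- A word of length n over the ordered alphabet Σ = {1,…,σ}, represented
-- (order-isomorphically) by Fin σ; positions are Fin n (0-based).
Word : ℕ → ℕ → Set
Word σ n = Fin n → Fin σ

data Label : Set where
  up right down : Label

data Edge {σ n : ℕ} (w : Word σ n) (i j : Fin n) : Label → Set where
  edge↑ : i < j → w i < w j →
          (∀ (k : Fin n) → i < k → k < j → (w k < w i) ⊎ (w k > w j)) →
          Edge w i j up
  edge→ : i < j → w i ≡ w j →
          (∀ (k : Fin n) → i < k → k < j → w k ≢ w j) →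
          Edge w i j right
  edge↓ : i < j → w i > w j →
          (∀ (k : Fin n) → i < k → k < j → (w k > w i) ⊎ (w k < w j)) →
          Edge w i j down

HasEdge : {σ n : ℕ} → Word σ n → Fin n → Fin n → Set
HasEdge w i j = ∃ (Edge w i j)

IsPath : {σ n j : ℕ} → Word σ n → Vec (Fin n) j → Set
IsPath w [] = ⊤
IsPath w (p ∷ []) = ⊤
IsPath w (p ∷ q ∷ ps) = HasEdge w p q × IsPath w (q ∷ ps)

Leftmost : {σ n : ℕ} → Word σ n → Fin n → Set
Leftmost {n = n} w i = ∀ (k : Fin n) → k < i → w k ≢ w i

{-# OPTIONS --safe #-}
-- An edge (v_i , v_j) forbids the letter w[j] strictly between i and j, so the
-- out-neighbours of a vertex carry pairwise distinct letters; likewise the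
-- leftmost occurrences carry distinct letters. Hence the letters of a path
-- determine its first vertex and then, step by step, every later vertex.
module Submission where

open import Defs
open import Data.Nat using (ℕ; suc)
open import Data.Fin using (Fin; _<_)
open import Data.Fin.Properties using (<-cmp; <-irrefl; <-asym)
open import Data.Vec using (Vec; map; head; []; _∷_)
open import Data.Vec.Properties using (∷-injective)
open import Data.Product using (_,_)
open import Data.Sum using (inj₁; inj₂)
open import Data.Empty using (⊥-elim)
open import Relation.Binary using (tri<; tri≈; tri>)
open import Relation.Binary.PropositionalEquality using (_≡_; _≢_; refl; sym; cong; subst)

module _ {σ n : ℕ} (w : Word σ n) where

  Edge⇒< : ∀ {i j l} → Edge w i j l → i < j
  Edge⇒< (edge↑ i<j _ _) = i<j
  Edge⇒< (edge→ i<j _ _) = i<j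
  Edge⇒< (edge↓ i<j _ _) = i<j

  Edge⇒target-letter-absent-between : ∀ {i j k l} → Edge w i j l →
                                      i < k → k < j → w k ≢ w j
  Edge⇒target-letter-absent-between {i} {k = k} (edge↑ _ wi<wj between) i<k k<j wk≡wj
    with between k i<k k<j
  ... | inj₁ wk<wi = <-asym wi<wj (subst (_< w i) wk≡wj wk<wi)
  ... | inj₂ wk>wj = <-irrefl (sym wk≡wj) wk>wj
  Edge⇒target-letter-absent-between {k = k} (edge→ _ _ between) i<k k<j =
    between k i<k k<j
  Edge⇒target-letter-absent-between {i} {k = k} (edge↓ _ wi>wj between) i<k k<j wk≡wj
    with between k i<k k<j
  ... | inj₁ wk>wi = <-asym wi>wj (subst (w i <_) wk≡wj wk>wi)
  ... | inj₂ wk<wj = <-irrefl wk≡wj wk<wj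

  HasEdge-target-injective : ∀ {i a b} → HasEdge w i a → HasEdge w i b →
                             w a ≡ w b → a ≡ b
  HasEdge-target-injective {a = a} {b} (_ , ia) (_ , ib) wa≡wb with <-cmp a b
  ... | tri< a<b _ _ = ⊥-elim (Edge⇒target-letter-absent-between ib (Edge⇒< ia) a<b wa≡wb)
  ... | tri≈ _ a≡b _ = a≡b
  ... | tri> _ _ b<a = ⊥-elim (Edge⇒target-letter-absent-between ia (Edge⇒< ib) b<a (sym wa≡wb))

  Leftmost-injective : ∀ {a b} → Leftmost w a → Leftmost w b → w a ≡ w b → a ≡ b
  Leftmost-injective {a} {b} leftmost-a leftmost-b wa≡wb with <-cmp a b
  ... | tri< a<b _ _ = ⊥-elim (leftmost-b a a<b wa≡wb)
  ... | tri≈ _ a≡b _ = a≡b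
  ... | tri> _ _ b<a = ⊥-elim (leftmost-a b b<a (sym wa≡wb))

  IsPath-determined-by-head-and-letters : ∀ {j} {p q : Vec (Fin n) (suc j)} →
    IsPath w p → IsPath w q → head p ≡ head q → map w p ≡ map w q → p ≡ q
  IsPath-determined-by-head-and-letters {p = _ ∷ []} {_ ∷ []} _ _ refl _ = refl
  IsPath-determined-by-head-and-letters {p = x ∷ a ∷ p} {.x ∷ b ∷ q}
    (xa , path-p) (xb , path-q) refl letters
    with ∷-injective letters
  ... | _ , tail-letters with ∷-injective tail-letters
  ... | wa≡wb , _ with HasEdge-target-injective xa xb wa≡wb
  ... | refl = cong (x ∷_)
    (IsPath-determined-by-head-and-letters path-p path-q refl tail-letters)

lemma18 : (σ n j : ℕ) (w : Word σ n) (p q : Vec (Fin n) (suc j)) →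
    IsPath w p → IsPath w q →
    Leftmost w (head p) → Leftmost w (head q) →
    map w p ≡ map w q → p ≡ q
lemma18 σ n j w (x ∷ p) (y ∷ q) path-p path-q leftmost-x leftmost-y letters
  with ∷-injective letters
... | wx≡wy , _ with Leftmost-injective w leftmost-x leftmost-y wx≡wy
... | refl = IsPath-determined-by-head-and-letters w path-p path-q refl letters
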